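{- For every integer $m\geq 1$, as formal power series in $q$, \[\sum_{n\geq 1} pc(n,m)\, q^n = \frac{q+2q^2-q^{m+1}}{1-2q^2-q^m}.\]
   Context: A composition of a positive integer $n$ of length $k$ is a sequence $\sigma=(\sigma_1,\ldots,\sigma_k)$ of positive integers with $\sum_i \sigma_i=n$. For an integer $m\geq 1$, $\sigma$ is palindromic modulo $m$ if $\sigma_i\equiv\sigma_{k-i+1}\pmod m$ for all $1\le i\le k$. $pc(n,m)$ denotes the number of compositions of $n$ that are palindromic modulo $m$. -}

module Defs where

open import Data.Nat as ℕ using (ℕ; zero; suc; NonZero; _≡ᵇ_)
open import Data.Nat.DivMod using (_%_)
open import Data.Integer as ℤ using (ℤ; +_)
open import Data.Bool using (if_then_else_)
open import Data.List using (List; []; _∷_; map; concatMap; filter; length; reverse; upTo)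
open import Data.Nat.ListAction using (sum)
open import Data.List.Relation.Binary.Pointwise using (Pointwise)
import Data.List.Relation.Binary.Pointwise.Properties as PW
open import Relation.Binary.PropositionalEquality using (_≡_)
open import Relation.Unary using (Decidable)
import Data.Nat.Properties as ℕP

allLists : List ℕ → ℕ → List (List ℕ)
allLists xs zero    = [] ∷ []
allLists xs (suc k) = concatMap (λ x → map (x ∷_) (allLists xs k)) xs

oneTo : ℕ → List ℕ
oneTo n = map suc (upTo n)

-- A composition of n has length ≤ n and parts in {1..n}; so the compositions
-- of n are exactly the lists of length k ≤ n with entries in {1..n} summing to n.
-- (Each appears exactly once.)
compositions : ℕ → List (List ℕ)
compositions n =
  filter (λ σ → sum σ ℕ.≟ n) (concatMap (allLists (oneTo n)) (0 ∷ oneTo n))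

PalindromicMod : (m : ℕ) → .{{NonZero m}} → List ℕ → Set
PalindromicMod m σ = Pointwise (λ x y → x % m ≡ y % m) σ (reverse σ)

palindromicMod? : (m : ℕ) → .{{_ : NonZero m}} → Decidable (PalindromicMod m)
palindromicMod? m σ = PW.decidable (λ x y → (x % m) ℕ.≟ (y % m)) σ (reverse σ)

pc : ℕ → (m : ℕ) → .{{NonZero m}} → ℕ
pc n m = length (filter (palindromicMod? m) (compositions n))

FPS : Set
FPS = ℕ → ℤ

infixl 6 _+ₛ_ _-ₛ_
infixl 7 _*ₛ_ _·ₛ_

_+ₛ_ : FPS → FPS → FPS
(f +ₛ g) n = f n ℤ.+ g n

_-ₛ_ : FPS → FPS → FPS
(f -ₛ g) n = f n ℤ.- g n

_·ₛ_ : ℤ → FPS → FPS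
(c ·ₛ f) n = c ℤ.* f n

_*ₛ_ : FPS → FPS → FPS
(f *ₛ g) n = Data.List.foldr ℤ._+_ (+ 0) (map (λ i → f i ℤ.* g (n ℕ.∸ i)) (upTo (suc n)))

q^ : ℕ → FPS
q^ k n = if n ≡ᵇ k then + 1 else + 0

one : FPS
one = q^ 0

pcGF : (m : ℕ) → .{{NonZero m}} → FPS
pcGF m zero    = + 0
pcGF m (suc n) = + pc (suc n) m

-- A composition of n that is palindromic modulo m has at most one part, or arises from a
-- palindromic one of n - a - b by adding a first part a and a last part b with a ≡ b (mod m).
-- With p = pc(-, m), so p(0) = 1, this gives p(n) = 1 + Σ_{a ≡ b} p(n - a - b). Among these
-- pairs, (1, 1) contributes p(n - 2), the pairs with exactly one part equal to 1 contribute
-- 2 z(n - 2) where z(k) = Σ_{j ≥ 1, jm ≤ k} p(k - jm), and the pairs with both parts ≥ 2 shift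
-- down to the sum for n - 2, which is p(n - 2) - 1. Hence p(k + 2) = 2 (p(k) + z(k)); since
-- z(k) = 0 for k < m and z(k + m) = p(k) + z(k), this makes (1 - 2q² - q^m) Σ_n p(n) q^n equal
-- to (1 + q)(1 - q^m), which is the claim once the constant term p(0) is removed.
module Submission where

open import Defs
open import Data.Nat using (ℕ; zero; suc; NonZero; >-nonZero⁻¹; pred; _+_; _*_; _∸_; _≤_; _<_; z≤n; s≤s; z<s; _≟_; _≤?_; _<?_)
open import Data.Nat.Properties
open import Data.Nat.DivMod using (_%_; %-distribˡ-+; [m+n]%n≡m%n; m<n⇒m%n≡m)
open import Data.Nat.Induction using (<-rec)
open import Algebra.Properties.CommutativeSemigroup +-commutativeSemigroup using () renaming (interchange to +-interchange)
open import Data.Nat.ListAction using (sum)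
open import Data.Nat.ListAction.Properties using (sum-++)
open import Data.Nat.Tactic.RingSolver renaming (solve-∀ to ℕ-solve)
open import Data.Bool using (true; false; if_then_else_)
open import Data.List using (List; []; _∷_; _++_; _∷ʳ_; map; concatMap; filter; length; reverse; applyUpTo; upTo; foldr)
open import Data.List.Properties using (reverse-++; unfold-reverse; map-applyUpTo; map-upTo; map-cong)
open import Data.List.Relation.Binary.Pointwise using (Pointwise; []; _∷_; ++⁺)
open import Data.Product using (_×_; _,_; proj₁)
open import Data.Sum using (inj₁; inj₂)
open import Level using (Level)
open import Function using (_∘_; _⇔_; mk⇔; Equivalence)
open import Relation.Nullary using (Dec; yes; no; does; ¬_; contradiction)
open import Relation.Nullary.Decidable using (_×-dec_)
open import Relation.Unary using (Decidable)
open import Relation.Binary.PropositionalEquality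

private variable
  ℓ : Level
  A B : Set ℓ
  P Q : Set ℓ

𝟙 : Dec P → ℕ
𝟙 d = if does d then 1 else 0

𝟙-yes : (d : Dec P) → P → 𝟙 d ≡ 1
𝟙-yes (yes _) _  = refl
𝟙-yes (no ¬p) p = contradiction p ¬p

𝟙-no : (d : Dec P) → ¬ P → 𝟙 d ≡ 0
𝟙-no (yes p) ¬p = contradiction p ¬p
𝟙-no (no _)  _  = refl

𝟙-cong : (d : Dec P) (e : Dec Q) → P ⇔ Q → 𝟙 d ≡ 𝟙 e
𝟙-cong d (yes q) P⇔Q = 𝟙-yes d (Equivalence.from P⇔Q q)
𝟙-cong d (no ¬q) P⇔Q = 𝟙-no d (¬q ∘ Equivalence.to P⇔Q)

𝟙-×-dec : (d : Dec P) (e : Dec Q) → 𝟙 (d ×-dec e) ≡ 𝟙 d * 𝟙 e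
𝟙-×-dec (yes _) (yes _) = refl
𝟙-×-dec (yes _) (no _)  = refl
𝟙-×-dec (no _)  _       = refl

sumBy : (A → ℕ) → List A → ℕ
sumBy f []       = 0
sumBy f (x ∷ xs) = f x + sumBy f xs

∑< : ℕ → (ℕ → ℕ) → ℕ
∑< zero    f = 0
∑< (suc n) f = f 0 + ∑< n (f ∘ suc)

syntax ∑< n (λ i → e) = ∑[ i < n ] e

length-filter-filter : ∀ {P Q : A → Set ℓ} (Q? : Decidable Q) (P? : Decidable P) xs →
  length (filter P? (filter Q? xs)) ≡ sumBy (λ x → 𝟙 (Q? x ×-dec P? x)) xs
length-filter-filter Q? P? [] = refl
length-filter-filter Q? P? (x ∷ xs) with does (Q? x)
... | false = length-filter-filter Q? P? xs
... | true with does (P? x)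
...   | false = length-filter-filter Q? P? xs
...   | true  = cong suc (length-filter-filter Q? P? xs)

sumBy-cong : ∀ {f g : A → ℕ} → (∀ x → f x ≡ g x) → ∀ xs → sumBy f xs ≡ sumBy g xs
sumBy-cong f≗g []       = refl
sumBy-cong f≗g (x ∷ xs) = cong₂ _+_ (f≗g x) (sumBy-cong f≗g xs)

sumBy-++ : ∀ (f : A → ℕ) xs ys → sumBy f (xs ++ ys) ≡ sumBy f xs + sumBy f ys
sumBy-++ f []       ys = refl
sumBy-++ f (x ∷ xs) ys = trans (cong (f x +_) (sumBy-++ f xs ys)) (sym (+-assoc (f x) _ _))

sumBy-distrib-+ : ∀ (f g : A → ℕ) xs → sumBy (λ x → f x + g x) xs ≡ sumBy f xs + sumBy g xs
sumBy-distrib-+ f g []       = refl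
sumBy-distrib-+ f g (x ∷ xs) = trans (cong (f x + g x +_) (sumBy-distrib-+ f g xs)) (+-interchange (f x) (g x) _ _)

sumBy-distribˡ-* : ∀ c (f : A → ℕ) xs → sumBy (λ x → c * f x) xs ≡ c * sumBy f xs
sumBy-distribˡ-* c f []       = sym (*-zeroʳ c)
sumBy-distribˡ-* c f (x ∷ xs) = trans (cong (c * f x +_) (sumBy-distribˡ-* c f xs)) (sym (*-distribˡ-+ c (f x) _))

sumBy-applyUpTo : ∀ (f : A → ℕ) (g : ℕ → A) n → sumBy f (applyUpTo g n) ≡ ∑[ i < n ] f (g i)
sumBy-applyUpTo f g zero    = refl
sumBy-applyUpTo f g (suc n) = cong (f (g 0) +_) (sumBy-applyUpTo f (g ∘ suc) n)

sumBy-map : ∀ (f : B → ℕ) (g : A → B) xs → sumBy f (map g xs) ≡ sumBy (f ∘ g) xs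
sumBy-map f g []       = refl
sumBy-map f g (x ∷ xs) = cong (f (g x) +_) (sumBy-map f g xs)

sumBy-concatMap : ∀ (f : B → ℕ) (g : A → List B) xs → sumBy f (concatMap g xs) ≡ sumBy (sumBy f ∘ g) xs
sumBy-concatMap f g []       = refl
sumBy-concatMap f g (x ∷ xs) = trans (sumBy-++ f (g x) (concatMap g xs)) (cong (sumBy f (g x) +_) (sumBy-concatMap f g xs))

sumBy-swap : ∀ (f : A → B → ℕ) xs ys → sumBy (λ x → sumBy (f x) ys) xs ≡ sumBy (λ y → sumBy (λ x → f x y) xs) ys
sumBy-swap f []       ys = sym (sumBy-zero ys)
  where sumBy-zero : ∀ ys → sumBy (λ _ → 0) ys ≡ 0
        sumBy-zero []       = refl
        sumBy-zero (_ ∷ ys) = sumBy-zero ys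
sumBy-swap f (x ∷ xs) ys = trans (cong (sumBy (f x) ys +_) (sumBy-swap f xs ys)) (sym (sumBy-distrib-+ (f x) _ ys))

∑<-cong : ∀ n {f g : ℕ → ℕ} → (∀ i → f i ≡ g i) → ∑[ i < n ] f i ≡ ∑[ i < n ] g i
∑<-cong zero    f≗g = refl
∑<-cong (suc n) f≗g = cong₂ _+_ (f≗g 0) (∑<-cong n (f≗g ∘ suc))

∑<-zero : ∀ n (f : ℕ → ℕ) → (∀ i → i < n → f i ≡ 0) → ∑[ i < n ] f i ≡ 0
∑<-zero zero    f f≡0 = refl
∑<-zero (suc n) f f≡0 = cong₂ _+_ (f≡0 0 z<s) (∑<-zero n (f ∘ suc) (λ i i<n → f≡0 (suc i) (s≤s i<n)))

∑<-single : ∀ n (f : ℕ → ℕ) {k} → k < n → (∀ i → i < n → i ≢ k → f i ≡ 0) → ∑[ i < n ] f i ≡ f k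
∑<-single (suc n) f {zero} _ f≡0 =
  trans (cong (f 0 +_) (∑<-zero n (f ∘ suc) (λ i i<n → f≡0 (suc i) (s≤s i<n) (λ ())))) (+-identityʳ (f 0))
∑<-single (suc n) f {suc k} (s≤s k<n) f≡0 =
  trans (cong (_+ ∑< n (f ∘ suc)) (f≡0 0 z<s (λ ())))
        (∑<-single n (f ∘ suc) k<n (λ i i<n i≢k → f≡0 (suc i) (s≤s i<n) (i≢k ∘ suc-injective)))

∑<-distrib-+ : ∀ n (f g : ℕ → ℕ) → ∑[ i < n ] (f i + g i) ≡ ∑[ i < n ] f i + ∑[ i < n ] g i
∑<-distrib-+ zero    f g = refl
∑<-distrib-+ (suc n) f g = trans (cong (f 0 + g 0 +_) (∑<-distrib-+ n (f ∘ suc) (g ∘ suc))) (+-interchange (f 0) (g 0) _ _)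

∑<-distribˡ-* : ∀ n c (f : ℕ → ℕ) → ∑[ i < n ] (c * f i) ≡ c * ∑[ i < n ] f i
∑<-distribˡ-* zero    c f = sym (*-zeroʳ c)
∑<-distribˡ-* (suc n) c f = trans (cong (c * f 0 +_) (∑<-distribˡ-* n c (f ∘ suc))) (sym (*-distribˡ-+ c (f 0) _))

∑<-swap : ∀ m n (f : ℕ → ℕ → ℕ) → ∑[ i < m ] ∑[ j < n ] f i j ≡ ∑[ j < n ] ∑[ i < m ] f i j
∑<-swap zero    n f = sym (∑<-zero n (λ _ → 0) (λ _ _ → refl))
∑<-swap (suc m) n f = trans (cong (∑< n (f 0) +_) (∑<-swap m n (f ∘ suc))) (sym (∑<-distrib-+ n (f 0) _))

∑<-+ : ∀ m n (f : ℕ → ℕ) → ∑[ i < m + n ] f i ≡ ∑[ i < m ] f i + ∑[ i < n ] f (m + i)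
∑<-+ zero    n f = refl
∑<-+ (suc m) n f = trans (cong (f 0 +_) (∑<-+ m n (f ∘ suc))) (sym (+-assoc (f 0) _ _))

∑<-extend : ∀ {m n} (f : ℕ → ℕ) → m ≤ n → (∀ i → m ≤ i → f i ≡ 0) → ∑[ i < n ] f i ≡ ∑[ i < m ] f i
∑<-extend {m} {n} f m≤n f≡0 = begin
  ∑< n f                                 ≡⟨ cong (λ k → ∑< k f) (sym (m+[n∸m]≡n m≤n)) ⟩
  ∑< (m + (n ∸ m)) f                     ≡⟨ ∑<-+ m (n ∸ m) f ⟩
  ∑< m f + ∑[ i < n ∸ m ] f (m + i)      ≡⟨ cong (∑< m f +_) (∑<-zero (n ∸ m) _ (λ i _ → f≡0 (m + i) (m≤m+n m i))) ⟩
  ∑< m f + 0                             ≡⟨ +-identityʳ _ ⟩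
  ∑< m f                                 ∎
  where open ≡-Reasoning

reverse-∷-∷ʳ : ∀ (a : A) xs b → reverse (a ∷ (xs ∷ʳ b)) ≡ b ∷ (reverse xs ∷ʳ a)
reverse-∷-∷ʳ a xs b = trans (unfold-reverse a (xs ∷ʳ b)) (cong (_∷ʳ a) (reverse-++ xs (b ∷ [])))

Pointwise-∷ʳ⁻ : ∀ {R : A → B → Set ℓ} xs ys {x y} → Pointwise R (xs ∷ʳ x) (ys ∷ʳ y) → Pointwise R xs ys × R x y
Pointwise-∷ʳ⁻ []       []       (r ∷ [])  = [] , r
Pointwise-∷ʳ⁻ []       (_ ∷ []) (_ ∷ ())
Pointwise-∷ʳ⁻ []       (_ ∷ _ ∷ _) (_ ∷ ())
Pointwise-∷ʳ⁻ (_ ∷ []) []       (_ ∷ ())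
Pointwise-∷ʳ⁻ (_ ∷ _ ∷ _) []    (_ ∷ ())
Pointwise-∷ʳ⁻ (_ ∷ xs) (_ ∷ ys) (r ∷ rs) with Pointwise-∷ʳ⁻ xs ys rs
... | rs′ , r′ = r ∷ rs′ , r′

sumBy-allLists-suc : ∀ (f : List ℕ → ℕ) xs k →
  sumBy f (allLists xs (suc k)) ≡ sumBy (λ x → sumBy (f ∘ (x ∷_)) (allLists xs k)) xs
sumBy-allLists-suc f xs k = trans (sumBy-concatMap f _ xs) (sumBy-cong (λ x → sumBy-map f (x ∷_) (allLists xs k)) xs)

sumBy-allLists-∷ʳ : ∀ (f : List ℕ → ℕ) xs k →
  sumBy f (allLists xs (suc k)) ≡ sumBy (λ x → sumBy (λ σ → f (σ ∷ʳ x)) (allLists xs k)) xs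
sumBy-allLists-∷ʳ f xs zero    = sumBy-allLists-suc f xs zero
sumBy-allLists-∷ʳ f xs (suc k) = begin
  sumBy f (allLists xs (2 + k))
    ≡⟨ sumBy-allLists-suc f xs (suc k) ⟩
  sumBy (λ y → sumBy (f ∘ (y ∷_)) (allLists xs (suc k))) xs
    ≡⟨ sumBy-cong (λ y → sumBy-allLists-∷ʳ (f ∘ (y ∷_)) xs k) xs ⟩
  sumBy (λ y → sumBy (λ x → sumBy (λ σ → f (y ∷ (σ ∷ʳ x))) (allLists xs k)) xs) xs
    ≡⟨ sumBy-swap (λ y x → sumBy (λ σ → f (y ∷ (σ ∷ʳ x))) (allLists xs k)) xs xs ⟩
  sumBy (λ x → sumBy (λ y → sumBy (λ σ → f (y ∷ (σ ∷ʳ x))) (allLists xs k)) xs) xs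
    ≡⟨ sumBy-cong (λ x → sym (sumBy-allLists-suc (λ τ → f (τ ∷ʳ x)) xs k)) xs ⟩
  sumBy (λ x → sumBy (λ σ → f (σ ∷ʳ x)) (allLists xs (suc k))) xs
    ∎
  where open ≡-Reasoning

sumBy-oneTo : ∀ (f : ℕ → ℕ) n → sumBy f (oneTo n) ≡ ∑[ i < n ] f (suc i)
sumBy-oneTo f n = trans (sumBy-map f suc (upTo n)) (sumBy-applyUpTo (f ∘ suc) (λ i → i) n)

sumBy-allLists-oneTo-vanish : ∀ N k (f : List ℕ → ℕ) → (∀ σ → k ≤ sum σ → f σ ≡ 0) →
  sumBy f (allLists (oneTo N) k) ≡ 0
sumBy-allLists-oneTo-vanish N zero    f f≡0 = cong (_+ 0) (f≡0 [] z≤n)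
sumBy-allLists-oneTo-vanish N (suc k) f f≡0 =
  trans (sumBy-allLists-suc f (oneTo N) k) (trans (sumBy-oneTo _ N) (∑<-zero N _ λ a _ →
    sumBy-allLists-oneTo-vanish N k (f ∘ (suc a ∷_)) λ σ k≤σ → f≡0 (suc a ∷ σ) (s≤s (≤-trans k≤σ (m≤n+m (sum σ) a)))))

m+n≡o⇔m≤o×n≡o∸m : ∀ {x s n} → x + s ≡ n ⇔ (x ≤ n × s ≡ n ∸ x)
m+n≡o⇔m≤o×n≡o∸m {x} {s} =
  mk⇔ (λ { refl → m≤m+n x s , sym (m+n∸m≡n x s) }) (λ { (x≤n , refl) → m+[n∸m]≡n x≤n })

module _ (m : ℕ) .{{_ : NonZero m}} where

  infix 4 _≡ₘ_
  _≡ₘ_ : ℕ → ℕ → Set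
  a ≡ₘ b = a % m ≡ b % m

  +-congʳ-≡ₘ : ∀ {a b} c → a ≡ₘ b → a + c ≡ₘ b + c
  +-congʳ-≡ₘ {a} {b} c a≡b = begin
    (a + c) % m           ≡⟨ %-distribˡ-+ a c m ⟩
    (a % m + c % m) % m   ≡⟨ cong (λ r → (r + c % m) % m) a≡b ⟩
    (b % m + c % m) % m   ≡⟨ %-distribˡ-+ b c m ⟨
    (b + c) % m           ∎
    where open ≡-Reasoning

  suc-≡ₘ : ∀ {a b} → suc a ≡ₘ suc b ⇔ a ≡ₘ b
  suc-≡ₘ {a} {b} = mk⇔ to from
    where
    suc+pred : ∀ x → suc x + pred m ≡ x + m
    suc+pred x = trans (sym (+-suc x (pred m))) (cong (x +_) (suc-pred m))
    to : suc a ≡ₘ suc b → a ≡ₘ b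
    to r = begin
      a % m                 ≡⟨ [m+n]%n≡m%n a m ⟨
      (a + m) % m           ≡⟨ cong (_% m) (suc+pred a) ⟨
      (suc a + pred m) % m  ≡⟨ +-congʳ-≡ₘ (pred m) r ⟩
      (suc b + pred m) % m  ≡⟨ cong (_% m) (suc+pred b) ⟩
      (b + m) % m           ≡⟨ [m+n]%n≡m%n b m ⟩
      b % m                 ∎
      where open ≡-Reasoning
    from : a ≡ₘ b → suc a ≡ₘ suc b
    from r = subst₂ _≡ₘ_ (+-comm a 1) (+-comm b 1) (+-congʳ-≡ₘ 1 r)

  palindromic-∷-∷ʳ : ∀ a σ b → PalindromicMod m (a ∷ (σ ∷ʳ b)) ⇔ (a ≡ₘ b × PalindromicMod m σ)
  palindromic-∷-∷ʳ a σ b rewrite reverse-∷-∷ʳ a σ b = mk⇔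
    (λ { (r ∷ rs) → r , proj₁ (Pointwise-∷ʳ⁻ σ (reverse σ) rs) })
    (λ { (r , rs) → r ∷ ++⁺ rs (sym r ∷ []) })

  weight : ℕ → List ℕ → ℕ
  weight n σ = 𝟙 (sum σ ≟ n ×-dec palindromicMod? m σ)

  ends : ℕ → ℕ → ℕ → ℕ
  ends a b n = 𝟙 (a % m ≟ b % m ×-dec a + b ≤? n)

  ends-overflow : ∀ {a b n} → n < a + b → ends a b n ≡ 0
  ends-overflow {a} {b} {n} n<a+b = trans (𝟙-×-dec (a % m ≟ b % m) (a + b ≤? n))
    (trans (cong (𝟙 (a % m ≟ b % m) *_) (𝟙-no (a + b ≤? n) (<⇒≱ n<a+b))) (*-zeroʳ (𝟙 (a % m ≟ b % m))))

  weight-∷-∷ʳ : ∀ n a σ b → weight n (a ∷ (σ ∷ʳ b)) ≡ ends a b n * weight (n ∸ (a + b)) σ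
  weight-∷-∷ʳ n a σ b = begin
    weight n (a ∷ (σ ∷ʳ b))
      ≡⟨ 𝟙-cong (sum (a ∷ (σ ∷ʳ b)) ≟ n ×-dec palindromicMod? m (a ∷ (σ ∷ʳ b)))
                (ends? ×-dec (sum σ ≟ n ∸ (a + b) ×-dec palindromicMod? m σ)) (mk⇔ to from) ⟩
    𝟙 (ends? ×-dec (sum σ ≟ n ∸ (a + b) ×-dec palindromicMod? m σ))
      ≡⟨ 𝟙-×-dec ends? (sum σ ≟ n ∸ (a + b) ×-dec palindromicMod? m σ) ⟩
    ends a b n * weight (n ∸ (a + b)) σ
      ∎
    where
    open ≡-Reasoning
    ends? : Dec (a ≡ₘ b × a + b ≤ n)
    ends? = a % m ≟ b % m ×-dec a + b ≤? n
    sum-∷-∷ʳ : sum (a ∷ (σ ∷ʳ b)) ≡ a + b + sum σ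
    sum-∷-∷ʳ = begin
      a + sum (σ ++ b ∷ [])    ≡⟨ cong (a +_) (sum-++ σ (b ∷ [])) ⟩
      a + (sum σ + (b + 0))    ≡⟨ rearrange a (sum σ) b ⟩
      a + b + sum σ            ∎
      where rearrange : ∀ x y z → x + (y + (z + 0)) ≡ x + z + y
            rearrange = ℕ-solve
    to : sum (a ∷ (σ ∷ʳ b)) ≡ n × PalindromicMod m (a ∷ (σ ∷ʳ b)) →
         (a ≡ₘ b × a + b ≤ n) × (sum σ ≡ n ∸ (a + b) × PalindromicMod m σ)
    to (s≡n , pal) with Equivalence.to m+n≡o⇔m≤o×n≡o∸m (trans (sym sum-∷-∷ʳ) s≡n)
                      | Equivalence.to (palindromic-∷-∷ʳ a σ b) pal
    ... | a+b≤n , sσ≡ | a≡b , palσ = (a≡b , a+b≤n) , (sσ≡ , palσ)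
    from : (a ≡ₘ b × a + b ≤ n) × (sum σ ≡ n ∸ (a + b) × PalindromicMod m σ) →
           sum (a ∷ (σ ∷ʳ b)) ≡ n × PalindromicMod m (a ∷ (σ ∷ʳ b))
    from ((a≡b , a+b≤n) , (sσ≡ , palσ)) =
      trans sum-∷-∷ʳ (Equivalence.from m+n≡o⇔m≤o×n≡o∸m (a+b≤n , sσ≡)) ,
      Equivalence.from (palindromic-∷-∷ʳ a σ b) (a≡b , palσ)

  -- Defs.compositions draws the parts from [1..n]; palCountUpTo-indep shows that the bound N
  -- on the parts is irrelevant once n ≤ N.
  palCount : ℕ → ℕ → ℕ → ℕ
  palCount N k n = sumBy (weight n) (allLists (oneTo N) k)

  palCountUpTo : ℕ → ℕ → ℕ
  palCountUpTo N n = ∑[ k < suc N ] palCount N k n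

  pc≡palCountUpTo : ∀ n → pc n m ≡ palCountUpTo n n
  pc≡palCountUpTo n = begin
    pc n m
      ≡⟨ length-filter-filter (λ σ → sum σ ≟ n) (palindromicMod? m) lists ⟩
    sumBy (weight n) lists
      ≡⟨ sumBy-concatMap (weight n) (allLists (oneTo n)) (0 ∷ oneTo n) ⟩
    palCount n 0 n + sumBy (λ k → palCount n k n) (oneTo n)
      ≡⟨ cong (palCount n 0 n +_) (sumBy-oneTo (λ k → palCount n k n) n) ⟩
    palCountUpTo n n
      ∎
    where
    open ≡-Reasoning
    lists : List (List ℕ)
    lists = concatMap (allLists (oneTo n)) (0 ∷ oneTo n)

  palCount-suc-suc : ∀ N k n →
    palCount N (2 + k) n ≡ ∑[ a < N ] ∑[ b < N ] (ends (suc a) (suc b) n * palCount N k (n ∸ (suc a + suc b)))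
  palCount-suc-suc N k n =
    trans (sumBy-allLists-suc (weight n) (oneTo N) (suc k)) (trans (sumBy-oneTo _ N) (∑<-cong N λ a →
    trans (sumBy-allLists-∷ʳ (weight n ∘ (suc a ∷_)) (oneTo N) k) (trans (sumBy-oneTo _ N) (∑<-cong N λ b →
    trans (sumBy-cong (λ σ → weight-∷-∷ʳ n (suc a) σ (suc b)) (allLists (oneTo N) k))
          (sumBy-distribˡ-* (ends (suc a) (suc b) n) _ (allLists (oneTo N) k))))))

  palCount-vanish : ∀ N {k n} → n < k → palCount N k n ≡ 0
  palCount-vanish N {k} {n} n<k = sumBy-allLists-oneTo-vanish N k (weight n) λ σ k≤σ →
    trans (𝟙-×-dec (sum σ ≟ n) (palindromicMod? m σ))
          (cong (_* 𝟙 (palindromicMod? m σ)) (𝟙-no (sum σ ≟ n) λ σ≡n → <⇒≱ n<k (subst (k ≤_) σ≡n k≤σ)))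

  palCount-0+1 : ∀ N {n} → n ≤ N → palCount N 0 n + palCount N 1 n ≡ 1
  palCount-0+1 N {n} n≤N = begin
    palCount N 0 n + palCount N 1 n
      ≡⟨ cong₂ _+_ (+-identityʳ (weight n [])) (trans (sumBy-allLists-suc (weight n) (oneTo N) 0) (sumBy-oneTo _ N)) ⟩
    weight n [] + ∑[ i < N ] (weight n (suc i ∷ []) + 0)
      ≡⟨ cong₂ _+_ (weight-[] n) (∑<-cong N λ i → trans (+-identityʳ _) (weight-[x] n (suc i))) ⟩
    𝟙 (0 ≟ n) + ∑[ i < N ] 𝟙 (suc i ≟ n)
      ≡⟨ only-one n n≤N ⟩
    1 ∎
    where
    open ≡-Reasoning
    weight-[] : ∀ n → weight n [] ≡ 𝟙 (0 ≟ n)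
    weight-[] n = trans (𝟙-×-dec (0 ≟ n) (palindromicMod? m [])) (*-identityʳ (𝟙 (0 ≟ n)))
    weight-[x] : ∀ n x → weight n (x ∷ []) ≡ 𝟙 (x ≟ n)
    weight-[x] n x = begin
      weight n (x ∷ [])
        ≡⟨ 𝟙-×-dec (x + 0 ≟ n) (palindromicMod? m (x ∷ [])) ⟩
      𝟙 (x + 0 ≟ n) * 𝟙 (palindromicMod? m (x ∷ []))
        ≡⟨ cong₂ _*_ (𝟙-cong (x + 0 ≟ n) (x ≟ n) (mk⇔ (trans (sym (+-identityʳ x))) (trans (+-identityʳ x))))
                     (𝟙-yes (palindromicMod? m (x ∷ [])) (refl ∷ [])) ⟩
      𝟙 (x ≟ n) * 1
        ≡⟨ *-identityʳ (𝟙 (x ≟ n)) ⟩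
      𝟙 (x ≟ n) ∎
    only-one : ∀ n → n ≤ N → 𝟙 (0 ≟ n) + ∑[ i < N ] 𝟙 (suc i ≟ n) ≡ 1
    only-one zero    _   = cong suc (∑<-zero N (λ i → 𝟙 (suc i ≟ 0)) λ i _ → 𝟙-no (suc i ≟ 0) λ ())
    only-one (suc n) n<N =
      trans (∑<-single N (λ i → 𝟙 (suc i ≟ suc n)) n<N λ i _ i≢n → 𝟙-no (suc i ≟ suc n) (i≢n ∘ suc-injective))
            (𝟙-yes (suc n ≟ suc n) refl)

  endSum : (ℕ → ℕ) → ℕ → ℕ → ℕ
  endSum f L n = ∑[ a < L ] ∑[ b < L ] (ends (suc a) (suc b) n * f (n ∸ (suc a + suc b)))

  palCountUpTo-firstLast : ∀ N {n} → n ≤ N → palCountUpTo N n ≡ 1 + endSum (palCountUpTo N) N n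
  palCountUpTo-firstLast N {n} n≤N = begin
    palCount N 0 n + ∑[ k < N ] palCount N (suc k) n
      ≡⟨ cong (palCount N 0 n +_) (∑<-extend (λ k → palCount N (suc k) n) (m≤n+m N 2) λ k N≤k →
            palCount-vanish N (s≤s (≤-trans n≤N N≤k))) ⟨
    palCount N 0 n + (palCount N 1 n + ∑[ k < suc N ] palCount N (2 + k) n)
      ≡⟨ +-assoc (palCount N 0 n) _ _ ⟨
    palCount N 0 n + palCount N 1 n + ∑[ k < suc N ] palCount N (2 + k) n
      ≡⟨ cong₂ _+_ (palCount-0+1 N n≤N) (∑<-cong (suc N) λ k → palCount-suc-suc N k n) ⟩
    1 + ∑[ k < suc N ] ∑[ a < N ] ∑[ b < N ] T a b k
      ≡⟨ cong (1 +_) (trans (∑<-swap (suc N) N λ k a → ∑[ b < N ] T a b k)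
                            (∑<-cong N λ a → ∑<-swap (suc N) N λ k b → T a b k)) ⟩
    1 + ∑[ a < N ] ∑[ b < N ] ∑[ k < suc N ] T a b k
      ≡⟨ cong (1 +_) (∑<-cong N λ a → ∑<-cong N λ b →
            ∑<-distribˡ-* (suc N) (ends (suc a) (suc b) n) (λ k → palCount N k (n ∸ (suc a + suc b)))) ⟩
    1 + endSum (palCountUpTo N) N n
      ∎
    where
    open ≡-Reasoning
    T : ℕ → ℕ → ℕ → ℕ
    T a b k = ends (suc a) (suc b) n * palCount N k (n ∸ (suc a + suc b))

  endSum-restrict : ∀ f {L n} → n ≤ L → endSum f L n ≡ endSum f n n
  endSum-restrict f {L} {n} n≤L =
    trans (∑<-cong L λ a → ∑<-extend _ n≤L λ b n≤b → vanish (≤-trans n≤b (m≤n+m b a)))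
          (∑<-extend _ n≤L λ a n≤a → ∑<-zero n _ λ b _ → vanish (≤-trans n≤a (m≤m+n a b)))
    where
    vanish : ∀ {a b} → n ≤ a + b → ends (suc a) (suc b) n * f (n ∸ (suc a + suc b)) ≡ 0
    vanish {a} {b} n≤a+b = cong (_* f (n ∸ (suc a + suc b)))
      (ends-overflow (s≤s (≤-trans n≤a+b (+-monoʳ-≤ a (n≤1+n b)))))

  endSum-cong< : ∀ {f g} L n → (∀ j → j < n → f j ≡ g j) → endSum f L n ≡ endSum g L n
  endSum-cong< {f} {g} L n f≡g = ∑<-cong L λ a → ∑<-cong L λ b → term (suc a + suc b ≤? n)
    where
    term : ∀ {a b} → Dec (suc a + suc b ≤ n) →
           ends (suc a) (suc b) n * f (n ∸ (suc a + suc b)) ≡ ends (suc a) (suc b) n * g (n ∸ (suc a + suc b))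
    term (yes a+b≤n) = cong (ends _ _ n *_) (f≡g _ (∸-monoʳ-< z<s a+b≤n))
    term (no  a+b≰n) = trans (cong (_* _) (ends-overflow (≰⇒> a+b≰n))) (sym (cong (_* _) (ends-overflow (≰⇒> a+b≰n))))

  palCountUpTo-indep : ∀ n {N N′} → n ≤ N → n ≤ N′ → palCountUpTo N n ≡ palCountUpTo N′ n
  palCountUpTo-indep = <-rec _ λ n rec {N} {N′} n≤N n≤N′ → begin
    palCountUpTo N n                   ≡⟨ palCountUpTo-firstLast N n≤N ⟩
    1 + endSum (palCountUpTo N) N n    ≡⟨ cong (1 +_) (endSum-restrict (palCountUpTo N) n≤N) ⟩
    1 + endSum (palCountUpTo N) n n    ≡⟨ cong (1 +_) (endSum-cong< n n λ j j<n →
                                            rec j<n (≤-trans (<⇒≤ j<n) n≤N) (≤-trans (<⇒≤ j<n) n≤N′)) ⟩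
    1 + endSum (palCountUpTo N′) n n   ≡⟨ cong (1 +_) (endSum-restrict (palCountUpTo N′) n≤N′) ⟨
    1 + endSum (palCountUpTo N′) N′ n  ≡⟨ palCountUpTo-firstLast N′ n≤N′ ⟨
    palCountUpTo N′ n                  ∎
    where open ≡-Reasoning

  pc-firstLast : ∀ n → pc n m ≡ 1 + endSum (λ j → pc j m) n n
  pc-firstLast n = begin
    pc n m                                   ≡⟨ pc≡palCountUpTo n ⟩
    palCountUpTo n n                         ≡⟨ palCountUpTo-firstLast n ≤-refl ⟩
    1 + endSum (palCountUpTo n) n n          ≡⟨ cong (1 +_) (endSum-cong< n n λ j j<n →
                                                  trans (palCountUpTo-indep j (<⇒≤ j<n) ≤-refl) (sym (pc≡palCountUpTo j))) ⟩
    1 + endSum (λ j → pc j m) n n            ∎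
    where open ≡-Reasoning

  ends-comm : ∀ a b n → ends a b n ≡ ends b a n
  ends-comm a b n = 𝟙-cong (a % m ≟ b % m ×-dec a + b ≤? n) (b % m ≟ a % m ×-dec b + a ≤? n)
    (mk⇔ (λ (r , le) → sym r , subst (_≤ n) (+-comm a b) le) (λ (r , le) → sym r , subst (_≤ n) (+-comm b a) le))

  ends-suc : ∀ a b n → ends (suc a) (suc b) (2 + n) ≡ ends a b n
  ends-suc a b n = 𝟙-cong (suc a % m ≟ suc b % m ×-dec suc a + suc b ≤? 2 + n) (a % m ≟ b % m ×-dec a + b ≤? n)
    (mk⇔ (λ (r , le) → Equivalence.to suc-≡ₘ r , ≤-pred (≤-pred (subst (_≤ 2 + n) (+-suc (suc a) b) le)))
         (λ (r , le) → Equivalence.from suc-≡ₘ r , subst (_≤ 2 + n) (sym (+-suc (suc a) b)) (s≤s (s≤s le))))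

  -- The pairs (1, b + 2) with b + 2 ≡ 1 (mod m): this is Σ_{j ≥ 1, jm ≤ n} f (n ∸ jm).
  endSum₁ : (ℕ → ℕ) → ℕ → ℕ
  endSum₁ f n = ∑[ b < suc n ] (ends 1 (2 + b) (2 + n) * f (n ∸ suc b))

  -- Split by whether the first or the last part is 1; pairs with both parts ≥ 2 shift down to n.
  endSum-suc-suc : ∀ f n → endSum f (2 + n) (2 + n) ≡ (f n + endSum₁ f n) + (endSum₁ f n + endSum f n n)
  endSum-suc-suc f n = begin
    (T 0 0 + endSum₁ f n) + ∑[ a < suc n ] (T (suc a) 0 + ∑[ b < suc n ] T (suc a) (suc b))
      ≡⟨ cong ((T 0 0 + endSum₁ f n) +_) (∑<-distrib-+ (suc n) (λ a → T (suc a) 0) λ a → ∑[ b < suc n ] T (suc a) (suc b)) ⟩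
    (T 0 0 + endSum₁ f n) + (∑[ a < suc n ] T (suc a) 0 + ∑[ a < suc n ] ∑[ b < suc n ] T (suc a) (suc b))
      ≡⟨ cong₂ (λ x y → (x + endSum₁ f n) + y) corner (cong₂ _+_ column inner) ⟩
    (f n + endSum₁ f n) + (endSum₁ f n + endSum f n n)
      ∎
    where
    open ≡-Reasoning
    T : ℕ → ℕ → ℕ
    T a b = ends (suc a) (suc b) (2 + n) * f (2 + n ∸ (suc a + suc b))
    corner : T 0 0 ≡ f n
    corner = trans (cong (_* f n) (𝟙-yes (1 % m ≟ 1 % m ×-dec 2 ≤? 2 + n) (refl , s≤s (s≤s z≤n)))) (+-identityʳ (f n))
    column : ∑[ a < suc n ] T (suc a) 0 ≡ endSum₁ f n
    column = ∑<-cong (suc n) λ a →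
      cong₂ _*_ (ends-comm (2 + a) 1 (2 + n)) (cong (λ k → f (n ∸ k)) (+-comm a 1))
    inner : ∑[ a < suc n ] ∑[ b < suc n ] T (suc a) (suc b) ≡ endSum f n n
    inner = trans (∑<-cong (suc n) λ a → ∑<-cong (suc n) λ b →
                     cong₂ _*_ (ends-suc (suc a) (suc b) n) (cong (λ k → f (n ∸ k)) (+-suc a (suc b))))
                  (endSum-restrict f (n≤1+n n))

  ends-+ : ∀ a b n → ends a (b + m) (n + m) ≡ ends a b n
  ends-+ a b n = 𝟙-cong (a % m ≟ (b + m) % m ×-dec a + (b + m) ≤? n + m) (a % m ≟ b % m ×-dec a + b ≤? n)
    (mk⇔ (λ (r , le) → trans r ([m+n]%n≡m%n b m) , +-cancelʳ-≤ m (a + b) n (subst (_≤ n + m) (sym (+-assoc a b m)) le))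
         (λ (r , le) → trans r (sym ([m+n]%n≡m%n b m)) , subst (_≤ n + m) (+-assoc a b m) (+-monoˡ-≤ m le)))

  1≢ₘ2+ : ∀ {b} → suc b < m → ¬ 1 ≡ₘ 2 + b
  1≢ₘ2+ {b} 1+b<m r = 0≢1+n (begin
    0          ≡⟨ m<n⇒m%n≡m (>-nonZero⁻¹ m) ⟨
    0 % m      ≡⟨ Equivalence.to suc-≡ₘ r ⟩
    suc b % m  ≡⟨ m<n⇒m%n≡m 1+b<m ⟩
    suc b      ∎)
    where open ≡-Reasoning

  ends-1-2+ : ∀ {b} n → suc b < m → ends 1 (2 + b) n ≡ 0
  ends-1-2+ {b} n 1+b<m = 𝟙-no (1 % m ≟ (2 + b) % m ×-dec 3 + b ≤? n) (1≢ₘ2+ 1+b<m ∘ proj₁)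

  endSum₁-< : ∀ f {n} → n < m → endSum₁ f n ≡ 0
  endSum₁-< f {n} n<m = ∑<-zero (suc n) _ λ b _ → cong (_* f (n ∸ suc b))
    (𝟙-no (1 % m ≟ (2 + b) % m ×-dec 3 + b ≤? 2 + n) λ (r , 3+b≤2+n) →
      1≢ₘ2+ (≤-trans (s≤s (≤-pred (≤-pred 3+b≤2+n))) n<m) r)

  endSum₁-+ : ∀ f n → endSum₁ f (n + m) ≡ f n + endSum₁ f n
  endSum₁-+ f n = begin
    endSum₁ f (n + m)                           ≡⟨ cong (λ k → ∑< k g) (+-comm (suc n) m) ⟩
    ∑[ b < m + suc n ] g b                      ≡⟨ ∑<-+ m (suc n) g ⟩
    ∑[ b < m ] g b + ∑[ b < suc n ] g (m + b)   ≡⟨ cong₂ _+_ first rest ⟩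
    f n + endSum₁ f n                           ∎
    where
    open ≡-Reasoning
    g : ℕ → ℕ
    g b = ends 1 (2 + b) (2 + (n + m)) * f (n + m ∸ suc b)
    at-pred : g (pred m) ≡ f n
    at-pred = begin
      ends 1 (2 + pred m) (2 + (n + m)) * f (n + m ∸ suc (pred m))
        ≡⟨ cong (λ k → ends 1 (suc k) (2 + (n + m)) * f (n + m ∸ k)) (suc-pred m) ⟩
      ends 1 (suc m) (2 + (n + m)) * f (n + m ∸ m)
        ≡⟨ cong₂ _*_ (𝟙-yes (1 % m ≟ suc m % m ×-dec 2 + m ≤? 2 + (n + m))
                            (sym ([m+n]%n≡m%n 1 m) , s≤s (s≤s (m≤n+m m n))))
                     (cong f (m+n∸n≡m n m)) ⟩
      1 * f n
        ≡⟨ *-identityˡ (f n) ⟩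
      f n ∎
    first : ∑[ b < m ] g b ≡ f n
    first = trans (∑<-single m g (≤-reflexive (suc-pred m)) λ b b<m b≢pred →
                     cong (_* f (n + m ∸ suc b)) (ends-1-2+ (2 + (n + m)) (≤∧≢⇒< b<m (b≢pred ∘ cong pred))))
                  at-pred
    rest : ∑[ b < suc n ] g (m + b) ≡ endSum₁ f n
    rest = ∑<-cong (suc n) λ b → cong₂ _*_
      (trans (cong (λ k → ends 1 (2 + k) (2 + (n + m))) (+-comm m b)) (ends-+ 1 (2 + b) (2 + n)))
      (cong f (trans (cong₂ _∸_ (+-comm n m) (sym (+-suc m b))) ([m+n]∸[m+o]≡n∸o m n (suc b))))

  pc-0 : pc 0 m ≡ 1
  pc-0 = pc-firstLast 0

  pc-1 : pc 1 m ≡ 1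
  pc-1 = trans (pc-firstLast 1) (cong (λ x → 1 + (x * pc 0 m + 0 + 0)) (ends-overflow (s≤s (s≤s z≤n))))

  pc-suc-suc : ∀ n → pc (2 + n) m ≡ 2 * (pc n m + endSum₁ (λ j → pc j m) n)
  pc-suc-suc n = begin
    pc (2 + n) m                            ≡⟨ pc-firstLast (2 + n) ⟩
    1 + endSum p (2 + n) (2 + n)            ≡⟨ cong (1 +_) (endSum-suc-suc p n) ⟩
    1 + ((p n + z) + (z + endSum p n n))    ≡⟨ rearrange (p n) z (endSum p n n) ⟩
    (p n + z) + (z + (1 + endSum p n n))    ≡⟨ cong (λ x → (p n + z) + (z + x)) (pc-firstLast n) ⟨
    (p n + z) + (z + p n)                   ≡⟨ double (p n) z ⟩
    2 * (p n + z)                           ∎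
    where
    open ≡-Reasoning
    p : ℕ → ℕ
    p j = pc j m
    z : ℕ
    z = endSum₁ p n
    rearrange : ∀ x y e → 1 + ((x + y) + (y + e)) ≡ (x + y) + (y + (1 + e))
    rearrange = ℕ-solve
    double : ∀ x y → (x + y) + (y + x) ≡ 2 * (x + y)
    double = ℕ-solve

-- Imported only here, since ℤ's prefix +_ makes sections such as (a +_) on ℕ ambiguous.
open import Data.Integer as ℤ using (ℤ; +_)
import Data.Integer.Properties as ℤP
open import Data.Integer.Tactic.RingSolver renaming (solve-∀ to ℤ-solve)

shift : ℕ → FPS → FPS
shift zero    f n       = f n
shift (suc k) f zero    = + 0
shift (suc k) f (suc n) = shift k f n

shift-+ : ∀ k f n → shift k f (k + n) ≡ f n
shift-+ zero    f n = refl
shift-+ (suc k) f n = shift-+ k f n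

shift-< : ∀ {k n} f → n < k → shift k f n ≡ + 0
shift-< {suc k} {zero}  f _           = refl
shift-< {suc k} {suc n} f (s≤s n<k) = shift-< f n<k

q^-≡ : ∀ k → q^ k k ≡ + 1
q^-≡ zero    = refl
q^-≡ (suc k) = q^-≡ k

q^-≢ : ∀ {k n} → n ≢ k → q^ k n ≡ + 0
q^-≢ {zero}  {zero}  n≢k = contradiction refl n≢k
q^-≢ {zero}  {suc n} _   = refl
q^-≢ {suc k} {zero}  _   = refl
q^-≢ {suc k} {suc n} n≢k = q^-≢ (n≢k ∘ cong suc)

Σℤ : List ℤ → ℤ
Σℤ = foldr ℤ._+_ (+ 0)

Σℤ-map-− : ∀ (f g : A → ℤ) xs → Σℤ (map (λ x → f x ℤ.- g x) xs) ≡ Σℤ (map f xs) ℤ.- Σℤ (map g xs)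
Σℤ-map-− f g []       = refl
Σℤ-map-− f g (x ∷ xs) = trans (cong (ℤ._+_ (f x ℤ.- g x)) (Σℤ-map-− f g xs)) (interchange (f x) (g x) _ _)
  where interchange : ∀ a b c d → a ℤ.- b ℤ.+ (c ℤ.- d) ≡ a ℤ.+ c ℤ.- (b ℤ.+ d)
        interchange = ℤ-solve

Σℤ-map-* : ∀ c (f : A → ℤ) xs → Σℤ (map (λ x → c ℤ.* f x) xs) ≡ c ℤ.* Σℤ (map f xs)
Σℤ-map-* c f []       = sym (ℤP.*-zeroʳ c)
Σℤ-map-* c f (x ∷ xs) = trans (cong (ℤ._+_ (c ℤ.* f x)) (Σℤ-map-* c f xs)) (sym (ℤP.*-distribˡ-+ c (f x) _))

Σℤ-zeros : ∀ n → Σℤ (applyUpTo (λ _ → + 0) n) ≡ + 0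
Σℤ-zeros zero    = refl
Σℤ-zeros (suc n) = trans (ℤP.+-identityˡ _) (Σℤ-zeros n)

*ₛ-distribʳ--ₛ : ∀ f g h n → ((f -ₛ g) *ₛ h) n ≡ (f *ₛ h) n ℤ.- (g *ₛ h) n
*ₛ-distribʳ--ₛ f g h n =
  trans (cong Σℤ (map-cong (λ i → distrib (f i) (g i) (h (n ∸ i))) (upTo (suc n))))
        (Σℤ-map-− (λ i → f i ℤ.* h (n ∸ i)) (λ i → g i ℤ.* h (n ∸ i)) (upTo (suc n)))
  where distrib : ∀ x y z → (x ℤ.- y) ℤ.* z ≡ x ℤ.* z ℤ.- y ℤ.* z
        distrib = ℤ-solve

·ₛ-*ₛ : ∀ c f h n → ((c ·ₛ f) *ₛ h) n ≡ c ℤ.* (f *ₛ h) n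
·ₛ-*ₛ c f h n =
  trans (cong Σℤ (map-cong (λ i → ℤP.*-assoc c (f i) (h (n ∸ i))) (upTo (suc n))))
        (Σℤ-map-* c (λ i → f i ℤ.* h (n ∸ i)) (upTo (suc n)))

q^-*ₛ : ∀ k f n → (q^ k *ₛ f) n ≡ shift k f n
q^-*ₛ zero f n = begin
  ℤ.1ℤ ℤ.* f n ℤ.+ Σℤ (map (λ i → q^ 0 i ℤ.* f (n ∸ i)) (applyUpTo suc n))
    ≡⟨ cong (ℤ._+_ (ℤ.1ℤ ℤ.* f n)) (trans (cong Σℤ (map-applyUpTo suc (λ i → q^ 0 i ℤ.* f (n ∸ i)) n)) (Σℤ-zeros n)) ⟩
  ℤ.1ℤ ℤ.* f n ℤ.+ + 0
    ≡⟨ trans (ℤP.+-identityʳ _) (ℤP.*-identityˡ (f n)) ⟩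
  f n ∎
  where open ≡-Reasoning
q^-*ₛ (suc k) f zero    = refl
q^-*ₛ (suc k) f (suc n) = begin
  + 0 ℤ.+ Σℤ (map (λ i → q^ (suc k) i ℤ.* f (suc n ∸ i)) (applyUpTo suc (suc n)))
    ≡⟨ ℤP.+-identityˡ _ ⟩
  Σℤ (map (λ i → q^ (suc k) i ℤ.* f (suc n ∸ i)) (applyUpTo suc (suc n)))
    ≡⟨ cong Σℤ (trans (map-applyUpTo suc (λ i → q^ (suc k) i ℤ.* f (suc n ∸ i)) (suc n))
                      (sym (map-upTo (λ i → q^ k i ℤ.* f (n ∸ i)) (suc n)))) ⟩
  (q^ k *ₛ f) n
    ≡⟨ q^-*ₛ k f n ⟩
  shift k f n ∎
  where open ≡-Reasoning

trinomial-*ₛ : ∀ c j k f n → ((one -ₛ c ·ₛ q^ j -ₛ q^ k) *ₛ f) n ≡ f n ℤ.- c ℤ.* shift j f n ℤ.- shift k f n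
trinomial-*ₛ c j k f n = begin
  ((one -ₛ c ·ₛ q^ j -ₛ q^ k) *ₛ f) n
    ≡⟨ *ₛ-distribʳ--ₛ (one -ₛ c ·ₛ q^ j) (q^ k) f n ⟩
  ((one -ₛ c ·ₛ q^ j) *ₛ f) n ℤ.- (q^ k *ₛ f) n
    ≡⟨ cong₂ ℤ._-_ (*ₛ-distribʳ--ₛ one (c ·ₛ q^ j) f n) (q^-*ₛ k f n) ⟩
  (one *ₛ f) n ℤ.- ((c ·ₛ q^ j) *ₛ f) n ℤ.- shift k f n
    ≡⟨ cong (ℤ._- shift k f n) (cong₂ ℤ._-_ (q^-*ₛ 0 f n) (trans (·ₛ-*ₛ c (q^ j) f n) (cong (c ℤ.*_) (q^-*ₛ j f n)))) ⟩
  f n ℤ.- c ℤ.* shift j f n ℤ.- shift k f n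
    ∎
  where open ≡-Reasoning

module _ (m : ℕ) .{{_ : NonZero m}} where

  pcLagSum : ℕ → ℕ
  pcLagSum = endSum₁ m (λ i → pc i m)

  pcGF-pc : ∀ n → pcGF m n ≡ + pc n m ℤ.- one n
  pcGF-pc zero    = cong (λ x → + x ℤ.- + 1) (sym (pc-0 m))
  pcGF-pc (suc n) = sym (ℤP.+-identityʳ _)

  shift-pcGF-≤ : ∀ {n} → n ≤ m → shift m (pcGF m) n ≡ + 0
  shift-pcGF-≤ {n} n≤m with m≤n⇒m<n∨m≡n n≤m
  ... | inj₁ n<m = shift-< (pcGF m) n<m
  ... | inj₂ n≡m = trans (cong (shift m (pcGF m)) (trans n≡m (sym (+-identityʳ m)))) (shift-+ m (pcGF m) 0)

  shift-pcGF-< : ∀ {k} → k < m → shift m (pcGF m) (2 + k) ≡ q^ (m + 1) (2 + k)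
  shift-pcGF-< {k} k<m with 2 + k ≤? m
  ... | yes 2+k≤m = trans (shift-pcGF-≤ 2+k≤m)
    (sym (q^-≢ λ 2+k≡m+1 → <-irrefl (trans 2+k≡m+1 (+-comm m 1)) (s≤s 2+k≤m)))
  ... | no  2+k≰m = begin
    shift m (pcGF m) (2 + k)   ≡⟨ cong (shift m (pcGF m)) (trans 2+k≡1+m (+-comm 1 m)) ⟩
    shift m (pcGF m) (m + 1)   ≡⟨ shift-+ m (pcGF m) 1 ⟩
    + pc 1 m                   ≡⟨ cong +_ (pc-1 m) ⟩
    + 1                        ≡⟨ q^-≡ (m + 1) ⟨
    q^ (m + 1) (m + 1)         ≡⟨ cong (q^ (m + 1)) (trans 2+k≡1+m (+-comm 1 m)) ⟨
    q^ (m + 1) (2 + k)         ∎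
    where
    open ≡-Reasoning
    2+k≡1+m : 2 + k ≡ suc m
    2+k≡1+m = ≤-antisym (s≤s k<m) (≰⇒> 2+k≰m)

  shift-pcGF-+ : ∀ j → shift m (pcGF m) (2 + (j + m)) ≡
                       + 2 ℤ.* + pcLagSum (j + m) ℤ.+ q^ (m + 1) (2 + (j + m))
  shift-pcGF-+ j = begin
    shift m (pcGF m) (2 + j + m)               ≡⟨ cong (shift m (pcGF m)) (+-comm (2 + j) m) ⟩
    shift m (pcGF m) (m + (2 + j))             ≡⟨ shift-+ m (pcGF m) (2 + j) ⟩
    + pc (2 + j) m                             ≡⟨ cong +_ (trans (pc-suc-suc m j) (cong (2 *_) (sym (endSum₁-+ m (λ i → pc i m) j)))) ⟩
    + (2 * pcLagSum (j + m))                   ≡⟨ ℤP.pos-* 2 (pcLagSum (j + m)) ⟩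
    + 2 ℤ.* + pcLagSum (j + m)                 ≡⟨ ℤP.+-identityʳ _ ⟨
    + 2 ℤ.* + pcLagSum (j + m) ℤ.+ + 0
      ≡⟨ cong (ℤ._+_ (+ 2 ℤ.* + pcLagSum (j + m))) (q^-≢ (>⇒≢ m+1<2+j+m)) ⟨
    + 2 ℤ.* + pcLagSum (j + m) ℤ.+ q^ (m + 1) (2 + (j + m)) ∎
    where
    open ≡-Reasoning
    m+1<2+j+m : m + 1 < 2 + (j + m)
    m+1<2+j+m = subst (_< 2 + (j + m)) (+-comm 1 m) (s≤s (s≤s (m≤n+m m j)))

  shift-pcGF : ∀ k → shift m (pcGF m) (2 + k) ≡ + 2 ℤ.* + pcLagSum k ℤ.+ q^ (m + 1) (2 + k)
  shift-pcGF k with k <? m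
  ... | no k≮m rewrite sym (m∸n+n≡m (≮⇒≥ k≮m)) = shift-pcGF-+ (k ∸ m)
  ... | yes k<m = begin
    shift m (pcGF m) (2 + k)   ≡⟨ shift-pcGF-< k<m ⟩
    q^ (m + 1) (2 + k)         ≡⟨ ℤP.+-identityˡ _ ⟨
    + 0 ℤ.+ q^ (m + 1) (2 + k) ≡⟨ cong (λ x → + 2 ℤ.* + x ℤ.+ q^ (m + 1) (2 + k)) (endSum₁-< m (λ i → pc i m) k<m) ⟨
    + 2 ℤ.* + pcLagSum k ℤ.+ q^ (m + 1) (2 + k) ∎
    where open ≡-Reasoning

  pcGF-coefficient : ∀ n → pcGF m n ℤ.- + 2 ℤ.* shift 2 (pcGF m) n ℤ.- shift m (pcGF m) n
                         ≡ (q^ 1 +ₛ (+ 2) ·ₛ q^ 2 -ₛ q^ (m + 1)) n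
  pcGF-coefficient zero = cong (ℤ._-_ (+ 0))
    (trans (shift-pcGF-≤ z≤n) (sym (q^-≢ λ 0≡m+1 → 0≢1+n (trans 0≡m+1 (+-comm m 1)))))
  pcGF-coefficient (suc zero) = cong₂ (λ x y → + x ℤ.- + 0 ℤ.- y) (pc-1 m)
    (trans (shift-pcGF-≤ (>-nonZero⁻¹ m)) (sym (q^-≢ (<⇒≢ (+-monoˡ-≤ 1 (>-nonZero⁻¹ m))))))
  pcGF-coefficient (suc (suc k)) = begin
    + pc (2 + k) m ℤ.- + 2 ℤ.* pcGF m k ℤ.- shift m (pcGF m) (2 + k)
      ≡⟨ cong₂ (λ x y → x ℤ.- + 2 ℤ.* y ℤ.- shift m (pcGF m) (2 + k)) pc-2+k (pcGF-pc k) ⟩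
    + 2 ℤ.* (+ pc k m ℤ.+ + pcLagSum k) ℤ.- + 2 ℤ.* (+ pc k m ℤ.- one k) ℤ.- shift m (pcGF m) (2 + k)
      ≡⟨ cong (ℤ._-_ (+ 2 ℤ.* (+ pc k m ℤ.+ + pcLagSum k) ℤ.- + 2 ℤ.* (+ pc k m ℤ.- one k))) (shift-pcGF k) ⟩
    + 2 ℤ.* (+ pc k m ℤ.+ + pcLagSum k) ℤ.- + 2 ℤ.* (+ pc k m ℤ.- one k) ℤ.- (+ 2 ℤ.* + pcLagSum k ℤ.+ q^ (m + 1) (2 + k))
      ≡⟨ cancel (+ pc k m) (+ pcLagSum k) (one k) (q^ (m + 1) (2 + k)) ⟩
    + 0 ℤ.+ + 2 ℤ.* one k ℤ.- q^ (m + 1) (2 + k)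
      ∎
    where
    open ≡-Reasoning
    pc-2+k : + pc (2 + k) m ≡ + 2 ℤ.* (+ pc k m ℤ.+ + pcLagSum k)
    pc-2+k = begin
      + pc (2 + k) m                       ≡⟨ cong +_ (pc-suc-suc m k) ⟩
      + (2 * (pc k m + pcLagSum k))        ≡⟨ ℤP.pos-* 2 (pc k m + pcLagSum k) ⟩
      + 2 ℤ.* + (pc k m + pcLagSum k)      ≡⟨ cong (+ 2 ℤ.*_) (ℤP.pos-+ (pc k m) (pcLagSum k)) ⟩
      + 2 ℤ.* (+ pc k m ℤ.+ + pcLagSum k)  ∎
    cancel : ∀ x y t r → + 2 ℤ.* (x ℤ.+ y) ℤ.- + 2 ℤ.* (x ℤ.- t) ℤ.- (+ 2 ℤ.* y ℤ.+ r) ≡ + 0 ℤ.+ + 2 ℤ.* t ℤ.- r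
    cancel = ℤ-solve

theorem1 : (m : ℕ) → .{{_ : NonZero m}} → (n : ℕ) →
    ((one -ₛ (+ 2) ·ₛ q^ 2 -ₛ q^ m) *ₛ pcGF m) n
    ≡ (q^ 1 +ₛ (+ 2) ·ₛ q^ 2 -ₛ q^ (m + 1)) n
theorem1 m n = trans (trinomial-*ₛ (+ 2) 2 m (pcGF m) n) (pcGF-coefficient m n)
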